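{- For each integer $n>4$, the tournament $U_n$ has exactly two sparse orderings. If $n$ is even, they are $\langle v_1, v_3,v_2, v_5,v_4,\dots, v_{n-1},v_{n-2}, v_n\rangle$ and $\langle v_2,v_1,v_4,v_3,\dots,v_n,v_{n-1}\rangle$. If $n$ is odd, they are $\langle v_2,v_1,v_4,v_3,\dots,v_{n-1},v_{n-2},v_n\rangle$ and $\langle v_1,v_3,v_2,v_5,v_4,\dots,v_n,v_{n-1}\rangle$.
   Context: For $n\ge1$, $U_n$ is the tournament with vertex set $\{v_1,\dots,v_n\}$ and arc set $\{(v_{i+1},v_i): 1\le i\le n-1\}\cup\{(v_i,v_j): 1\le i<n,\ i+1<j\le n\}$. Given an ordering $\langle w_1,\dots,w_n\rangle$ of the vertices, an arc $(w_i,w_j)$ is backward if $j<i$. An ordering is sparse if every vertex is incident to at most one backward arc. -}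

module Defs where

open import Data.Nat using (ℕ; zero; suc; _+_; _∸_; _<_; z≤n; s≤s)
open import Data.Fin using (Fin; toℕ; fromℕ<)
open import Data.Product using (_×_)
open import Data.Sum using (_⊎_)
open import Relation.Binary.PropositionalEquality using (_≡_)
open import Function.Definitions using (Injective)

-- Vertices of U_n: Fin n, where index i (0-based) stands for v_{i+1}.
-- Arcs of U_n (0-based translation of the paper's definition):
--   (v_{i+1}, v_i) for 1 ≤ i ≤ n-1   ↦  toℕ a ≡ suc (toℕ b)
--   (v_i, v_j) for i < n, i+1 < j    ↦  suc (toℕ a) < toℕ b   (i < n is then automatic)
data UArc (n : ℕ) (a b : Fin n) : Set where
  down : toℕ a ≡ suc (toℕ b) → UArc n a b
  jump : suc (toℕ a) < toℕ b → UArc n a b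

-- An ordering ⟨w_1,…,w_n⟩ of the vertices: w maps positions to vertices,
-- and is a bijection (for Fin n → Fin n, injectivity is equivalent).
IsOrdering : (n : ℕ) → (Fin n → Fin n) → Set
IsOrdering n w = Injective _≡_ _≡_ w

Backward : (n : ℕ) → (Fin n → Fin n) → Fin n → Fin n → Set
Backward n w i j = (toℕ j < toℕ i) × UArc n (w i) (w j)

Incident : {n : ℕ} → Fin n → Fin n → Fin n → Set
Incident p i j = (p ≡ i) ⊎ (p ≡ j)

Sparse : (n : ℕ) → (Fin n → Fin n) → Set
Sparse n w = ∀ (p i j i' j' : Fin n) →
  Backward n w i j → Incident p i j →
  Backward n w i' j' → Incident p i' j' →
  (i ≡ i') × (j ≡ j')

-- The two orderings, as functions position ↦ vertex index (0-based).
-- swapFirstℕ n : ⟨v_2,v_1,v_4,v_3,…⟩, ending with v_n,v_{n-1} (n even)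
--                or with v_{n-1},v_{n-2},v_n (n odd).
swapFirstℕ : ℕ → ℕ → ℕ
swapFirstℕ zero zero = 0
swapFirstℕ (suc zero) zero = 0
swapFirstℕ (suc (suc n)) zero = 1
swapFirstℕ n (suc zero) = 0
swapFirstℕ n (suc (suc k)) = 2 + swapFirstℕ (n ∸ 2) k

-- swapShiftedℕ n : ⟨v_1,v_3,v_2,v_5,v_4,…⟩, ending with v_{n-1},v_{n-2},v_n (n even)
--                  or with v_n,v_{n-1} (n odd).
swapShiftedℕ : ℕ → ℕ → ℕ
swapShiftedℕ n zero = 0
swapShiftedℕ n (suc k) = 1 + swapFirstℕ (n ∸ 1) k

swapFirst-< : ∀ n k → k < n → swapFirstℕ n k < n
swapFirst-< (suc (suc n)) zero _ = s≤s (s≤s z≤n)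
swapFirst-< (suc zero) zero _ = s≤s z≤n
swapFirst-< (suc (suc n)) (suc zero) _ = s≤s z≤n
swapFirst-< (suc zero) (suc k) (s≤s ())
swapFirst-< (suc (suc n)) (suc (suc k)) (s≤s (s≤s k<n)) =
  s≤s (s≤s (swapFirst-< n k k<n))

swapShifted-< : ∀ n k → k < n → swapShiftedℕ n k < n
swapShifted-< (suc n) zero _ = s≤s z≤n
swapShifted-< (suc n) (suc k) (s≤s k<n) = s≤s (swapFirst-< n k k<n)

swapFirst : (n : ℕ) → Fin n → Fin n
swapFirst n k = fromℕ< (swapFirst-< n (toℕ k) (Data.Fin.Properties.toℕ<n k))
  where import Data.Fin.Properties

swapShifted : (n : ℕ) → Fin n → Fin n
swapShifted n k = fromℕ< (swapShifted-< n (toℕ k) (Data.Fin.Properties.toℕ<n k))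
  where import Data.Fin.Properties

{-# OPTIONS --safe #-}
-- Both orderings move every vertex by at most one place, so each of
-- their backward arcs joins consecutive vertices x + 1 → x, with x odd in one ordering and even
-- in the other; such arcs never share a vertex.
-- Conversely, for n ≥ 5 vertex 0 is the source of no backward arc: any vertex z ≥ 2 with an
-- arc into its target would give a second backward arc at the source or at the target.
-- So the first vertex is 0 or 1. Call a settled if the positions below a hold exactly the
-- vertices below a and vertex a lies on no backward arc within the positions ≥ a; then
-- positions a and a + 1 hold a + 1 and a (anything else creates a backward arc at vertex a),
-- and a + 2 is settled. Starting from a = 0 (first vertex 1) or a = 1 (first vertex 0)
-- this forces the two orderings.
module Submission where

open import Defs
open import Data.Bool using (Bool; true; false; not)
open import Data.Bool.Properties using (not-involutive; not-¬)
open import Data.Nat using (ℕ; zero; suc; _+_; _∸_; _<_; _≤_; z≤n; s≤s)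
open import Data.Nat.Properties
open import Data.Fin as Fin using (Fin; toℕ; fromℕ<; punchOut)
open import Data.Fin.Properties
  using (toℕ-injective; toℕ-fromℕ<; toℕ<n; any?; punchOut-injective; injective⇒≤)
  renaming (_≟_ to _≟ᶠ_)
open import Data.Product using (_×_; map; _,_; proj₁; proj₂; ∃-syntax)
open import Data.Empty using (⊥; ⊥-elim)
open import Data.Sum using (_⊎_; inj₁; inj₂; [_,_])
open import Function.Definitions using (Injective)
open import Relation.Nullary using (¬_; yes; no; contradiction)
open import Relation.Binary.Definitions using (tri<; tri≈; tri>)
open import Relation.Binary.PropositionalEquality
  using (_≡_; _≢_; refl; sym; trans; cong; subst; subst₂; _≗_; module ≡-Reasoning)

injective⇒surjective : ∀ {n} {f : Fin n → Fin n} → Injective _≡_ _≡_ f → ∀ y → ∃[ x ] f x ≡ y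
injective⇒surjective {zero} _ ()
injective⇒surjective {suc n} {f} f-injective y with any? (λ x → f x ≟ᶠ y)
... | yes hit = hit
... | no miss = contradiction (injective⇒≤ punched-injective) 1+n≰n
  where
  y≢f : ∀ x → y ≢ f x
  y≢f x eq = miss (x , sym eq)

  punched-injective : Injective _≡_ _≡_ (λ x → punchOut (y≢f x))
  punched-injective eq = f-injective (punchOut-injective (y≢f _) (y≢f _) eq)

isOdd : ℕ → Bool
isOdd zero = false
isOdd (suc n) = not (isOdd n)

isOdd-suc-≢ : ∀ {b} x → isOdd x ≡ b → isOdd (suc x) ≢ b
isOdd-suc-≢ x odd-x odd-sx = not-¬ refl (trans odd-x (sym odd-sx))

s≤s² : ∀ {m n} → m ≤ n → suc (suc m) ≤ suc (suc n)
s≤s² m≤n = s≤s (s≤s m≤n)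

+-suc-suc : ∀ m n → m + suc (suc n) ≡ suc (suc (m + n))
+-suc-suc m n = trans (+-suc m (suc n)) (cong suc (+-suc m n))

module OrderingOfℕMap {n : ℕ} (f : ℕ → ℕ) (w : Fin n → Fin n)
                      (w≈f : ∀ p → toℕ (w p) ≡ f (toℕ p)) where

  involutive⇒isOrdering : (∀ k → k < n → f (f k) ≡ k) → IsOrdering n w
  involutive⇒isOrdering f-involutive {p} {q} wp≡wq = toℕ-injective (begin
    toℕ p               ≡⟨ sym (f-involutive (toℕ p) (toℕ<n p)) ⟩
    f (f (toℕ p))       ≡⟨ cong f (sym (w≈f p)) ⟩
    f (toℕ (w p))       ≡⟨ cong (λ v → f (toℕ v)) wp≡wq ⟩
    f (toℕ (w q))       ≡⟨ cong f (w≈f q) ⟩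
    f (f (toℕ q))       ≡⟨ f-involutive (toℕ q) (toℕ<n q) ⟩
    toℕ q               ∎)
    where open ≡-Reasoning

  module _ (w-ordering : IsOrdering n w)
           (displacement : ∀ k → f k ≤ suc k × k ≤ suc (f k)) where

    -- A jump arc (f i, f j) with f j ≥ f i + 2 would need j ≥ i, since values move by at most one.
    backward⇒down : ∀ {i j} → Backward n w i j → f (toℕ i) ≡ suc (f (toℕ j))
    backward⇒down {i} {j} (_ , down e) = trans (sym (w≈f i)) (trans e (cong suc (w≈f j)))
    backward⇒down {i} {j} (j<i , jump lt) = contradiction
      (≤-trans (proj₁ (displacement (toℕ j))) (≤-trans j<i (proj₂ (displacement (toℕ i)))))
      (<⇒≱ (subst₂ (λ x y → suc x < y) (w≈f i) (w≈f j) lt))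

    fToℕ-injective : ∀ {p q} → f (toℕ p) ≡ f (toℕ q) → p ≡ q
    fToℕ-injective {p} {q} e = w-ordering (toℕ-injective (trans (w≈f p) (trans e (sym (w≈f q)))))

    -- A value shared by two backward arcs would make two lower ends consecutive.
    alternating⇒sparse : (b : Bool) →
      (∀ j i → j < i → i < n → f i ≡ suc (f j) → isOdd (f j) ≡ b) → Sparse n w
    alternating⇒sparse b parity = sparse
      where
      down-parity : ∀ {i j} → Backward n w i j → isOdd (f (toℕ j)) ≡ b
      down-parity {i} {j} bk = parity (toℕ j) (toℕ i) (proj₁ bk) (toℕ<n i) (backward⇒down bk)

      sparse : Sparse n w
      sparse p .p j .p j' bk (inj₁ refl) bk' (inj₁ refl) =
        refl , fToℕ-injective (suc-injective (trans (sym (backward⇒down bk)) (backward⇒down bk')))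
      sparse p i .p i' .p bk (inj₂ refl) bk' (inj₂ refl) =
        fToℕ-injective (trans (backward⇒down bk) (sym (backward⇒down bk'))) , refl
      sparse p .p j i' .p bk (inj₁ refl) bk' (inj₂ refl) = contradiction
        (subst (λ x → isOdd x ≡ b) (backward⇒down bk) (down-parity bk'))
        (isOdd-suc-≢ (f (toℕ j)) (down-parity bk))
      sparse p i .p .p j' bk (inj₂ refl) bk' (inj₁ refl) = contradiction
        (subst (λ x → isOdd x ≡ b) (backward⇒down bk') (down-parity bk))
        (isOdd-suc-≢ (f (toℕ j')) (down-parity bk'))

swapFirstℕ-involutive : ∀ n k → k < n → swapFirstℕ n (swapFirstℕ n k) ≡ k
swapFirstℕ-involutive (suc zero) zero _ = refl
swapFirstℕ-involutive (suc (suc n)) zero _ = refl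
swapFirstℕ-involutive (suc (suc n)) (suc zero) _ = refl
swapFirstℕ-involutive (suc zero) (suc k) (s≤s ())
swapFirstℕ-involutive (suc (suc n)) (suc (suc k)) (s≤s (s≤s k<n)) =
  cong (λ x → suc (suc x)) (swapFirstℕ-involutive n k k<n)

swapFirstℕ-displacement : ∀ n k → swapFirstℕ n k ≤ suc k × k ≤ suc (swapFirstℕ n k)
swapFirstℕ-displacement zero zero = z≤n , z≤n
swapFirstℕ-displacement (suc zero) zero = z≤n , z≤n
swapFirstℕ-displacement (suc (suc n)) zero = s≤s z≤n , z≤n
swapFirstℕ-displacement zero (suc zero) = z≤n , s≤s z≤n
swapFirstℕ-displacement (suc zero) (suc zero) = z≤n , s≤s z≤n
swapFirstℕ-displacement (suc (suc n)) (suc zero) = z≤n , s≤s z≤n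
swapFirstℕ-displacement zero (suc (suc k)) = map s≤s² s≤s² (swapFirstℕ-displacement zero k)
swapFirstℕ-displacement (suc zero) (suc (suc k)) = map s≤s² s≤s² (swapFirstℕ-displacement zero k)
swapFirstℕ-displacement (suc (suc n)) (suc (suc k)) = map s≤s² s≤s² (swapFirstℕ-displacement n k)

swapFirstℕ-backward-odd : ∀ n j i → j < i → i < n →
  swapFirstℕ n i ≡ suc (swapFirstℕ n j) → isOdd (swapFirstℕ n j) ≡ true
swapFirstℕ-backward-odd (suc zero) zero (suc i) _ (s≤s ()) _
swapFirstℕ-backward-odd (suc (suc n)) zero i _ _ _ = refl
swapFirstℕ-backward-odd (suc (suc n)) (suc zero) (suc (suc i)) _ _ ()
swapFirstℕ-backward-odd (suc (suc n)) (suc zero) (suc zero) (s≤s ()) _ _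
swapFirstℕ-backward-odd (suc zero) (suc j) (suc i) _ (s≤s ()) _
swapFirstℕ-backward-odd (suc (suc n)) (suc (suc j)) (suc (suc i)) (s≤s (s≤s j<i)) (s≤s (s≤s i<n)) e =
  trans (not-involutive _) (swapFirstℕ-backward-odd n j i j<i i<n (suc-injective (suc-injective e)))

swapShiftedℕ-involutive : ∀ n k → k < n → swapShiftedℕ n (swapShiftedℕ n k) ≡ k
swapShiftedℕ-involutive (suc n) zero _ = refl
swapShiftedℕ-involutive (suc n) (suc k) (s≤s k<n) = cong suc (swapFirstℕ-involutive n k k<n)

swapShiftedℕ-displacement : ∀ n k → swapShiftedℕ n k ≤ suc k × k ≤ suc (swapShiftedℕ n k)
swapShiftedℕ-displacement n zero = z≤n , z≤n
swapShiftedℕ-displacement n (suc k) = map s≤s s≤s (swapFirstℕ-displacement (n ∸ 1) k)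

swapShiftedℕ-backward-even : ∀ n j i → j < i → i < n →
  swapShiftedℕ n i ≡ suc (swapShiftedℕ n j) → isOdd (swapShiftedℕ n j) ≡ false
swapShiftedℕ-backward-even n zero i _ _ _ = refl
swapShiftedℕ-backward-even (suc n) (suc j) (suc i) (s≤s j<i) (s≤s i<n) e =
  cong not (swapFirstℕ-backward-odd n j i j<i i<n (suc-injective e))

toℕ-swapFirst : ∀ {n} p → toℕ (swapFirst n p) ≡ swapFirstℕ n (toℕ p)
toℕ-swapFirst p = toℕ-fromℕ< _

toℕ-swapShifted : ∀ {n} p → toℕ (swapShifted n p) ≡ swapShiftedℕ n (toℕ p)
toℕ-swapShifted p = toℕ-fromℕ< _

swapFirst-isOrdering : ∀ n → IsOrdering n (swapFirst n)
swapFirst-isOrdering n = involutive⇒isOrdering (swapFirstℕ-involutive n)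
  where open OrderingOfℕMap (swapFirstℕ n) (swapFirst n) toℕ-swapFirst

swapFirst-sparse : ∀ n → Sparse n (swapFirst n)
swapFirst-sparse n = alternating⇒sparse (swapFirst-isOrdering n) (swapFirstℕ-displacement n)
  true (swapFirstℕ-backward-odd n)
  where open OrderingOfℕMap (swapFirstℕ n) (swapFirst n) toℕ-swapFirst

swapShifted-isOrdering : ∀ n → IsOrdering n (swapShifted n)
swapShifted-isOrdering n = involutive⇒isOrdering (swapShiftedℕ-involutive n)
  where open OrderingOfℕMap (swapShiftedℕ n) (swapShifted n) toℕ-swapShifted

swapShifted-sparse : ∀ n → Sparse n (swapShifted n)
swapShifted-sparse n = alternating⇒sparse (swapShifted-isOrdering n) (swapShiftedℕ-displacement n)
  false (swapShiftedℕ-backward-even n)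
  where open OrderingOfℕMap (swapShiftedℕ n) (swapShifted n) toℕ-swapShifted

swapFirst≢swapShifted : ∀ n → ¬ (swapFirst (suc (suc n)) ≗ swapShifted (suc (suc n)))
swapFirst≢swapShifted n same with () ← cong toℕ (same Fin.zero)

UArc⇒toℕ≢ : ∀ {n a b} → UArc n a b → toℕ a ≢ toℕ b
UArc⇒toℕ≢ (down e) a≡b = 1+n≢n (trans (sym e) a≡b)
UArc⇒toℕ≢ {a = a} (jump lt) a≡b =
  1+n≰n (≤-trans (n≤1+n _) (subst (λ x → suc (suc (toℕ a)) ≤ x) (sym a≡b) lt))

-- Needs n > 4: for y = 3 the only candidate is z = 4.
arcInto : ∀ {n} y → 2 ≤ y → 4 < n → ∃[ z ] z < n × 2 ≤ z × z ≢ y × (z ≡ suc y ⊎ suc z < y)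
arcInto (suc zero) (s≤s ()) _
arcInto (suc (suc zero)) _ 4<n = 3 , <⇒≤ 4<n , s≤s² z≤n , (λ ()) , inj₁ refl
arcInto (suc (suc (suc zero))) _ 4<n = 4 , 4<n , s≤s² z≤n , (λ ()) , inj₁ refl
arcInto (suc (suc (suc (suc y)))) _ 4<n =
  2 , ≤-trans (s≤s² (s≤s z≤n)) (<⇒≤ 4<n) , s≤s² z≤n , (λ ()) , inj₂ (s≤s² (s≤s² z≤n))

module SparseOrdering {n : ℕ} {w : Fin (suc n) → Fin (suc n)}
                      (w-ordering : IsOrdering (suc n) w) (w-sparse : Sparse (suc n) w) where

  N : ℕ
  N = suc n

  V : Fin N → ℕ
  V p = toℕ (w p)

  V-injective : ∀ {p q} → V p ≡ V q → p ≡ q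
  V-injective e = w-ordering (toℕ-injective e)

  position : ∀ {x} → x < N → ∃[ q ] V q ≡ x
  position x<N with q , wq≡x ← injective⇒surjective w-ordering (fromℕ< x<N) =
    q , trans (cong toℕ wq≡x) (toℕ-fromℕ< x<N)

  ≤∧V≢⇒< : ∀ {p q} → toℕ p ≤ toℕ q → V p ≢ V q → toℕ p < toℕ q
  ≤∧V≢⇒< p≤q Vp≢Vq = ≤∧≢⇒< p≤q (λ p≡q → Vp≢Vq (cong V (toℕ-injective p≡q)))

  uniqueTarget : ∀ {i j k} → Backward N w i j → Backward N w i k → j ≡ k
  uniqueTarget bk bk' = proj₂ (w-sparse _ _ _ _ _ bk (inj₁ refl) bk' (inj₁ refl))

  uniqueSource : ∀ {i j k} → Backward N w i j → Backward N w k j → i ≡ k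
  uniqueSource bk bk' = proj₁ (w-sparse _ _ _ _ _ bk (inj₂ refl) bk' (inj₂ refl))

  noBackwardPath : ∀ {i j k} → Backward N w i j → Backward N w j k → ⊥
  noBackwardPath {i} {j} {k} bk@(j<i , _) bk' =
    <-irrefl (cong toℕ (sym (proj₁ (w-sparse j i j j k bk (inj₂ refl) bk' (inj₁ refl))))) j<i

  sucFreeAfter : ∀ {p i j} → Backward N w i j → toℕ p < toℕ j →
                 V i ≢ suc (V p) × V j ≢ suc (V p)
  sucFreeAfter bk@(j<i , _) p<j =
    (λ Vi≡ → <-irrefl (cong toℕ (sym (uniqueTarget bk (<-trans p<j j<i , down Vi≡)))) p<j) ,
    (λ Vj≡ → noBackwardPath bk (p<j , down Vj≡))

  -- Placed before i, q is a second backward target of i; placed after i, a second backward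
  -- source for j.
  backwardFrom0-noArcInto : ∀ {i j q} → Backward N w i j → V i ≡ 0 → 2 ≤ V q → V q ≢ V j →
                            V q ≡ suc (V j) ⊎ suc (V q) < V j → ⊥
  backwardFrom0-noArcInto {i} {j} {q} bk@(j<i , _) Vi≡0 2≤Vq Vq≢Vj q⇀j
    with <-≤-connex (toℕ q) (toℕ i)
  ... | inj₁ q<i = Vq≢Vj (cong V (sym (uniqueTarget bk bk-iq)))
    where
    bk-iq : Backward N w i q
    bk-iq = q<i , jump (subst (λ x → suc x < V q) (sym Vi≡0) 2≤Vq)
  ... | inj₂ i≤q = m<n⇒n≢0 2≤Vq (trans (cong V (sym (uniqueSource bk bk-qj))) Vi≡0)
    where
    bk-qj : Backward N w q j
    bk-qj = <-≤-trans j<i i≤q , [ down , jump ] q⇀j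

  source≢0 : 4 < N → ∀ {i j} → Backward N w i j → V i ≢ 0
  source≢0 _ (_ , down e) Vi≡0 = 0≢1+n (trans (sym Vi≡0) e)
  source≢0 4<N {j = j} bk@(_ , jump lt) Vi≡0
    with z , z<N , 2≤z , z≢Vj , z⇀Vj ← arcInto (V j) (subst (λ x → suc x < V j) Vi≡0 lt) 4<N
    with q , refl ← position z<N
    = backwardFrom0-noArcInto bk Vi≡0 2≤z z≢Vj z⇀Vj

  V-zero≤1 : 4 < N → V Fin.zero ≤ 1
  V-zero≤1 4<N = ≮⇒≥ λ 1<V₀ →
    let q , Vq≡0 = position {0} (s≤s z≤n)
        0<q = ≤∧V≢⇒< z≤n (λ V₀≡Vq → m<n⇒n≢0 1<V₀ (trans V₀≡Vq Vq≡0))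
    in source≢0 4<N (0<q , jump (subst (λ x → suc x < V Fin.zero) (sym Vq≡0) 1<V₀)) Vq≡0

  record Settled (a : ℕ) : Set where
    field
      prefix : ∀ p → toℕ p < a → V p < a
      suffix : ∀ p → a ≤ toℕ p → a ≤ V p
      fresh  : ∀ {i j} → Backward N w i j → a ≤ toℕ j → V i ≢ a × V j ≢ a

    suffix⁻¹ : ∀ q → a ≤ V q → a ≤ toℕ q
    suffix⁻¹ q a≤Vq = ≮⇒≥ (λ q<a → <⇒≱ (prefix q q<a) a≤Vq)

    forward : ∀ {i j} → a ≤ toℕ i → a ≤ toℕ j → V i ≡ a ⊎ V j ≡ a →
              UArc N (w i) (w j) → toℕ i < toℕ j
    forward {i} {j} a≤i a≤j touches-a arc with <-≤-connex (toℕ j) (toℕ i)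
    ... | inj₁ j<i = ⊥-elim ([ proj₁ fresh-ij , proj₂ fresh-ij ] touches-a)
      where fresh-ij = fresh (j<i , arc) a≤j
    ... | inj₂ i≤j = ≤∧V≢⇒< i≤j (UArc⇒toℕ≢ arc)

  open Settled

  settled-head : ∀ {a} → suc a < N → Settled a → ∀ {p} → toℕ p ≡ a → V p ≡ suc a
  settled-head {a} a+1<N s {p} p≡a with <-cmp (V p) (suc a)
  ... | tri≈ _ Vp≡a+1 _ = Vp≡a+1
  ... | tri< Vp<a+1 _ _ with q , Vq≡a+1 ← position a+1<N = contradiction
    (subst (_≤ toℕ q) (sym p≡a) a≤q)
    (<⇒≱ (forward s a≤q a≤p (inj₂ Vp≡a) (down (trans Vq≡a+1 (cong suc (sym Vp≡a))))))
    where
    a≤p = ≤-reflexive (sym p≡a)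
    Vp≡a = ≤-antisym (≤-pred Vp<a+1) (suffix s p a≤p)
    a≤q = suffix⁻¹ s q (subst (a ≤_) (sym Vq≡a+1) (n≤1+n a))
  ... | tri> _ _ a+1<Vp with q , Vq≡a ← position (<-trans (n<1+n a) a+1<N) = contradiction
    (subst (_≤ toℕ q) (sym p≡a) a≤q)
    (<⇒≱ (forward s a≤q a≤p (inj₁ Vq≡a) (jump (subst (λ x → suc x < V p) (sym Vq≡a) a+1<Vp))))
    where
    a≤p = ≤-reflexive (sym p≡a)
    a≤q = suffix⁻¹ s q (≤-reflexive (sym Vq≡a))

  settled-next : ∀ {a} → suc a < N → Settled a → ∀ {p} → toℕ p ≡ suc a → V p ≡ a
  settled-next {a} a+1<N s {p} p≡a+1 with <-cmp (V p) (suc a)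
  ... | tri< Vp<a+1 _ _ = ≤-antisym (≤-pred Vp<a+1) (suffix s p (subst (a ≤_) (sym p≡a+1) (n≤1+n a)))
  ... | tri≈ _ Vp≡a+1 _ = ⊥-elim (1+n≢n (begin
    suc a                ≡⟨ sym p≡a+1 ⟩
    toℕ p                ≡⟨ cong toℕ (V-injective (trans Vp≡a+1 (sym Vp₀))) ⟩
    toℕ (fromℕ< a<N)     ≡⟨ toℕ-fromℕ< a<N ⟩
    a                    ∎))
    where
    a<N = <-trans (n<1+n a) a+1<N
    Vp₀ = settled-head a+1<N s (toℕ-fromℕ< a<N)
    open ≡-Reasoning
  ... | tri> _ _ a+1<Vp with q , Vq≡a ← position (<-trans (n<1+n a) a+1<N) =
    contradiction (trans (sym (settled-head a+1<N s q≡a)) Vq≡a) 1+n≢n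
    where
    a≤p = subst (a ≤_) (sym p≡a+1) (n≤1+n a)
    a≤q = suffix⁻¹ s q (≤-reflexive (sym Vq≡a))
    q<p = forward s a≤q a≤p (inj₁ Vq≡a) (jump (subst (λ x → suc x < V p) (sym Vq≡a) a+1<Vp))
    q≡a = ≤-antisym (≤-pred (subst (toℕ q <_) p≡a+1 q<p)) a≤q

  settled-advance : ∀ {a} → suc a < N → Settled a → Settled (suc (suc a))
  settled-advance {a} a+1<N s = record { prefix = prefix′ ; suffix = suffix′ ; fresh = fresh′ }
    where
    a<N = <-trans (n<1+n a) a+1<N
    p₀ = fromℕ< a<N
    p₁ = fromℕ< a+1<N
    Vp₀ : V p₀ ≡ suc a
    Vp₀ = settled-head a+1<N s (toℕ-fromℕ< a<N)
    Vp₁ : V p₁ ≡ a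
    Vp₁ = settled-next a+1<N s (toℕ-fromℕ< a+1<N)

    prefix′ : ∀ p → toℕ p < suc (suc a) → V p < suc (suc a)
    prefix′ p p<a+2 with m≤n⇒m<n∨m≡n (≤-pred p<a+2)
    ... | inj₂ p≡a+1 = s≤s (≤-trans (≤-reflexive (settled-next a+1<N s p≡a+1)) (n≤1+n a))
    ... | inj₁ p<a+1 with m≤n⇒m<n∨m≡n (≤-pred p<a+1)
    ...   | inj₁ p<a = m<n⇒m<1+n (m<n⇒m<1+n (prefix s p p<a))
    ...   | inj₂ p≡a = s≤s (≤-reflexive (settled-head a+1<N s p≡a))

    suffix′ : ∀ p → suc (suc a) ≤ toℕ p → suc (suc a) ≤ V p
    suffix′ p a+2≤p = ≤∧≢⇒< (≤∧≢⇒< (suffix s p a≤p) a≢Vp) a+1≢Vp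
      where
      a+1≤p = ≤-trans (n≤1+n _) a+2≤p
      a≤p = ≤-trans (n≤1+n a) a+1≤p
      a≢Vp : a ≢ V p
      a≢Vp a≡Vp = <-irrefl
        (trans (sym (toℕ-fromℕ< a+1<N)) (cong toℕ (V-injective (trans Vp₁ a≡Vp)))) a+2≤p
      a+1≢Vp : suc a ≢ V p
      a+1≢Vp a+1≡Vp = <-irrefl
        (trans (sym (toℕ-fromℕ< a<N)) (cong toℕ (V-injective (trans Vp₀ a+1≡Vp)))) a+1≤p

    fresh′ : ∀ {i j} → Backward N w i j → suc (suc a) ≤ toℕ j →
             V i ≢ suc (suc a) × V j ≢ suc (suc a)
    fresh′ {i} {j} bk a+2≤j = subst (λ x → V i ≢ suc x × V j ≢ suc x) Vp₀
      (sucFreeAfter {p = p₀} bk (subst (_< toℕ j) (sym (toℕ-fromℕ< a<N)) (≤-trans (n≤1+n _) a+2≤j)))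

  settled-last : ∀ {a} → suc a ≡ N → Settled a → ∀ {p} → toℕ p ≡ a → V p ≡ a
  settled-last a+1≡N s {p} p≡a =
    ≤-antisym (≤-pred (subst (V p <_) (sym a+1≡N) (toℕ<n (w p)))) (suffix s p (≤-reflexive (sym p≡a)))

  roomForTwo : ∀ {a} d → suc (suc d) + a ≡ N → suc a < N
  roomForTwo {a} d eq = subst (suc a <_) eq (s≤s² (m≤n+m a d))

  settled⇒swapFirst : ∀ a d → d + a ≡ N → Settled a →
                      ∀ k {p} → toℕ p ≡ k + a → V p ≡ swapFirstℕ d k + a
  settled⇒swapFirst a zero a≡N _ k {p} p≡k+a =
    ⊥-elim (<⇒≱ (toℕ<n p) (subst₂ _≤_ a≡N (sym p≡k+a) (m≤n+m a k)))
  settled⇒swapFirst a (suc zero) a+1≡N s zero p≡a = settled-last a+1≡N s p≡a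
  settled⇒swapFirst a (suc zero) a+1≡N _ (suc k) {p} p≡k+a+1 =
    ⊥-elim (<⇒≱ (toℕ<n p) (subst₂ _≤_ a+1≡N (sym p≡k+a+1) (s≤s (m≤n+m a k))))
  settled⇒swapFirst a (suc (suc d)) d+a+2≡N s zero p≡a =
    settled-head (roomForTwo d d+a+2≡N) s p≡a
  settled⇒swapFirst a (suc (suc d)) d+a+2≡N s (suc zero) p≡a+1 =
    settled-next (roomForTwo d d+a+2≡N) s p≡a+1
  settled⇒swapFirst a (suc (suc d)) d+a+2≡N s (suc (suc k)) p≡k+a+2 =
    trans (settled⇒swapFirst (suc (suc a)) d (trans (+-suc-suc d a) d+a+2≡N)
             (settled-advance (roomForTwo d d+a+2≡N) s) k (trans p≡k+a+2 (sym (+-suc-suc k a))))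
          (+-suc-suc (swapFirstℕ d k) a)

  V-zero≡1⇒settled₀ : 4 < N → V Fin.zero ≡ 1 → Settled 0
  V-zero≡1⇒settled₀ 4<N V₀≡1 = record
    { prefix = λ _ ()
    ; suffix = λ _ _ → z≤n
    ; fresh = λ bk _ → source≢0 4<N bk , target≢0 bk
    }
    where
    target≢0 : ∀ {i j} → Backward N w i j → V j ≢ 0
    target≢0 {i} (j<i , down Vi≡Vj+1) Vj≡0
      with refl ← V-injective {i} {Fin.zero} (trans Vi≡Vj+1 (trans (cong suc Vj≡0) (sym V₀≡1))) = n≮0 j<i
    target≢0 {i} (_ , jump lt) Vj≡0 = n≮0 (subst (suc (V i) <_) Vj≡0 lt)

  V-zero≡0⇒settled₁ : V Fin.zero ≡ 0 → Settled 1
  V-zero≡0⇒settled₁ V₀≡0 = record { prefix = prefix′ ; suffix = suffix′ ; fresh = fresh′ }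
    where
    prefix′ : ∀ p → toℕ p < 1 → V p < 1
    prefix′ p p<1 with refl ← toℕ-injective {i = p} {j = Fin.zero} (n<1⇒n≡0 p<1) =
      s≤s (≤-reflexive V₀≡0)

    suffix′ : ∀ p → 1 ≤ toℕ p → 1 ≤ V p
    suffix′ p 0<p = n≢0⇒n>0 λ Vp≡0 →
      <⇒≢ 0<p (sym (cong toℕ (V-injective (trans Vp≡0 (sym V₀≡0)))))

    fresh′ : ∀ {i j} → Backward N w i j → 1 ≤ toℕ j → V i ≢ 1 × V j ≢ 1
    fresh′ {i} {j} bk 0<j =
      subst (λ x → V i ≢ suc x × V j ≢ suc x) V₀≡0 (sucFreeAfter {p = Fin.zero} bk 0<j)

  settled₀⇒swapFirst : Settled 0 → w ≗ swapFirst N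
  settled₀⇒swapFirst s p = toℕ-injective (begin
    V p                       ≡⟨ settled⇒swapFirst 0 N (+-identityʳ N) s (toℕ p) (sym (+-identityʳ (toℕ p))) ⟩
    swapFirstℕ N (toℕ p) + 0  ≡⟨ +-identityʳ (swapFirstℕ N (toℕ p)) ⟩
    swapFirstℕ N (toℕ p)      ≡⟨ toℕ-swapFirst p ⟨
    toℕ (swapFirst N p)       ∎)
    where open ≡-Reasoning

  settled₁⇒swapShifted : V Fin.zero ≡ 0 → Settled 1 → w ≗ swapShifted N
  settled₁⇒swapShifted V₀≡0 _ Fin.zero = toℕ-injective V₀≡0
  settled₁⇒swapShifted _ s (Fin.suc p) = toℕ-injective (begin
    V (Fin.suc p)                    ≡⟨ settled⇒swapFirst 1 n (+-comm n 1) s (toℕ p) (+-comm 1 (toℕ p)) ⟩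
    swapFirstℕ n (toℕ p) + 1         ≡⟨ +-comm (swapFirstℕ n (toℕ p)) 1 ⟩
    suc (swapFirstℕ n (toℕ p))       ≡⟨ toℕ-swapShifted (Fin.suc p) ⟨
    toℕ (swapShifted N (Fin.suc p))  ∎)
    where open ≡-Reasoning

  sparse⇒swapFirst⊎swapShifted : 4 < N → (w ≗ swapFirst N) ⊎ (w ≗ swapShifted N)
  sparse⇒swapFirst⊎swapShifted 4<N with m≤n⇒m<n∨m≡n (V-zero≤1 4<N)
  ... | inj₂ V₀≡1 = inj₁ (settled₀⇒swapFirst (V-zero≡1⇒settled₀ 4<N V₀≡1))
  ... | inj₁ V₀<1 = inj₂ (settled₁⇒swapShifted V₀≡0 (V-zero≡0⇒settled₁ V₀≡0))
    where V₀≡0 = n<1⇒n≡0 V₀<1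

mainTheorem6 : ∀ (n : ℕ) → 4 < n →
    IsOrdering n (swapFirst n) × Sparse n (swapFirst n) ×
    IsOrdering n (swapShifted n) × Sparse n (swapShifted n) ×
    ¬ (swapFirst n ≗ swapShifted n) ×
    (∀ (w : Fin n → Fin n) → IsOrdering n w → Sparse n w →
      (w ≗ swapFirst n) ⊎ (w ≗ swapShifted n))
mainTheorem6 (suc (suc n)) 4<n =
  swapFirst-isOrdering _ , swapFirst-sparse _ ,
  swapShifted-isOrdering _ , swapShifted-sparse _ ,
  swapFirst≢swapShifted n ,
  λ w w-ordering w-sparse → SparseOrdering.sparse⇒swapFirst⊎swapShifted w-ordering w-sparse 4<n
mainTheorem6 (suc zero) (s≤s ())
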